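{- Let SSF-I run on $m$ identical machines (of any common speed). For any two machines $x,y$, any integer $k$ and any time $t$, $|R^x_{\le k}(t) - R^y_{\le k}(t)| \le 2^{k+3}$.
   Context: Requests $J_i$ arrive online with arrival time $a_i$, deadline $d_i$, processing time $\ell_i$ and slack $S_i = d_i - a_i \ge \ell_i$; preemption is allowed. A request is in class $k$ if $S_i\in[2^k,2^{k+1})$. $U^x_{=k}(t)$ is the total processing time of class-$k$ requests assigned to machine $x$ by time $t$, and $U^x_{\le k}(t)$ the analogous total over classes $\le k$. SSF-I: an arriving class-$k$ request at time $t$ is immediately and permanently assigned to a machine $x$ with $U^x_{=k}(t)=\min_y U^y_{=k}(t)$, and each machine runs shortest-slack-first on its assigned requests. $P^x_{\le k}(t)$ is the volume machine $x$ has completed by time $t$ on requests of classes $\le k$, and $R^x_{\le k}(t) = U^x_{\le k}(t) - P^x_{\le k}(t)$ is the remaining processing time on machine $x$ of such requests.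
   Formalization: Arrival times, deadlines, processing times, the common machine speed, the schedule's switching times and the time $t$ are all rational. -}

module Defs where

open import Data.Nat as ℕ using (ℕ; zero; suc)
open import Data.Integer as ℤ using (ℤ; +_; -[1+_])
import Data.Integer.Properties as ℤP
open import Data.Rational using (ℚ; 0ℚ; 1ℚ; ½; _+_; _*_; _-_; _≤_; _<_; _⊔_; _⊓_)
open import Data.Rational.Properties using (_≤?_)
open import Data.Fin as Fin using (Fin; zero; suc; inject₁)
import Data.Fin.Properties as FinP
open import Data.Maybe using (Maybe; just; nothing)
open import Data.Product using (Σ; _×_; ∃-syntax)
open import Relation.Binary.PropositionalEquality using (_≡_)
open import Relation.Nullary using (Dec; yes; no; ¬_)

when : ∀ {p} {P : Set p} → Dec P → ℚ → ℚ
when (yes _) q = q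
when (no _)  _ = 0ℚ

sumFin : ∀ {n} → (Fin n → ℚ) → ℚ
sumFin {zero}  f = 0ℚ
sumFin {suc n} f = f zero + sumFin (λ i → f (suc i))

pw : ℚ → ℕ → ℚ
pw q zero    = 1ℚ
pw q (suc n) = q * pw q n

two : ℚ
two = 1ℚ + 1ℚ

pow2 : ℤ → ℚ
pow2 (+ n)    = pw two n
pow2 -[1+ n ] = pw ½ (suc n)

-- Requests: n requests indexed by Fin n (in arrival order),
-- arrival a, deadline d, processing time ℓ, slack S = d - a.

slack : ∀ {n} (a d : Fin n → ℚ) → Fin n → ℚ
slack a d i = d i - a i

InClass : ℤ → ℚ → Set
InClass k S = pow2 k ≤ S × S < pow2 (k ℤ.+ + 1)

ValidInstance : ∀ {n} (a d ℓ : Fin n → ℚ) (cls : Fin n → ℤ) → Set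
ValidInstance {n} a d ℓ cls =
    (∀ i → 0ℚ ≤ ℓ i)
  × (∀ i → ℓ i ≤ slack a d i)
  × (∀ i → InClass (cls i) (slack a d i))
  × (∀ (i j : Fin n) → i Fin.< j → a i ≤ a j)

-- U^x_{=k} at the moment request i arrives: class-k volume assigned to x
-- by requests that arrived before i (earlier index).
loadBefore : ∀ {n m} (ℓ : Fin n → ℚ) (cls : Fin n → ℤ) (asg : Fin n → Fin m)
             → Fin m → ℤ → Fin n → ℚ
loadBefore ℓ cls asg x k i =
  sumFin (λ j → when (j FinP.<? i) (when (asg j FinP.≟ x) (when (cls j ℤP.≟ k) (ℓ j))))

SSF-I-Assignment : ∀ {n m} (ℓ : Fin n → ℚ) (cls : Fin n → ℤ) (asg : Fin n → Fin m) → Set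
SSF-I-Assignment ℓ cls asg =
  ∀ i y → loadBefore ℓ cls asg (asg i) (cls i) i ≤ loadBefore ℓ cls asg y (cls i) i

U≤ : ∀ {n m} (a ℓ : Fin n → ℚ) (cls : Fin n → ℤ) (asg : Fin n → Fin m)
     → Fin m → ℤ → ℚ → ℚ
U≤ a ℓ cls asg x k t =
  sumFin (λ j → when (a j ≤? t) (when (asg j FinP.≟ x) (when (cls j ℤP.≤? k) (ℓ j))))

-- Preemptive schedules (piecewise constant): breakpoints τ 0 < … < τ N;
-- on [τ r, τ (r+1)) machine x runs run r x (or idles); idle outside [τ 0, τ N).
-- Every machine processes at speed s.

module _ {N : ℕ} (τ : Fin (suc N) → ℚ) where
  lo : Fin N → ℚ
  lo r = τ (inject₁ r)

  hi : Fin N → ℚ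
  hi r = τ (suc r)

  lenBefore : Fin N → ℚ → ℚ
  lenBefore r t = 0ℚ ⊔ ((hi r ⊓ t) - lo r)

runsJob : ∀ {n} → Maybe (Fin n) → Fin n → ℚ → ℚ
runsJob nothing   j q = 0ℚ
runsJob (just j') j q = when (j' FinP.≟ j) q

runsLe : ∀ {n} (cls : Fin n → ℤ) → ℤ → Maybe (Fin n) → ℚ → ℚ
runsLe cls k nothing  q = 0ℚ
runsLe cls k (just j) q = when (cls j ℤP.≤? k) q

work : ∀ {n m N} (s : ℚ) (τ : Fin (suc N) → ℚ) (run : Fin N → Fin m → Maybe (Fin n))
       → Fin n → ℚ → ℚ
work s τ run j t = s * sumFin (λ r → sumFin (λ x → runsJob (run r x) j (lenBefore τ r t)))

P≤ : ∀ {n m N} (s : ℚ) (cls : Fin n → ℤ) (τ : Fin (suc N) → ℚ)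
     (run : Fin N → Fin m → Maybe (Fin n)) → Fin m → ℤ → ℚ → ℚ
P≤ s cls τ run x k t = s * sumFin (λ r → runsLe cls k (run r x) (lenBefore τ r t))

R≤ : ∀ {n m N} (s : ℚ) (a ℓ : Fin n → ℚ) (cls : Fin n → ℤ) (asg : Fin n → Fin m)
     (τ : Fin (suc N) → ℚ) (run : Fin N → Fin m → Maybe (Fin n)) → Fin m → ℤ → ℚ → ℚ
R≤ s a ℓ cls asg τ run x k t = U≤ a ℓ cls asg x k t - P≤ s cls τ run x k t

RunsAt : ∀ {n m N} (τ : Fin (suc N) → ℚ) (run : Fin N → Fin m → Maybe (Fin n))
         → Fin m → ℚ → Fin n → Set
RunsAt τ run x t j = ∃[ r ] (lo τ r ≤ t × t < hi τ r × run r x ≡ just j)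

Idle : ∀ {n m N} (τ : Fin (suc N) → ℚ) (run : Fin N → Fin m → Maybe (Fin n))
       → Fin m → ℚ → Set
Idle τ run x t = ∀ r → lo τ r ≤ t → t < hi τ r → run r x ≡ nothing

Pending : ∀ {n m N} (s : ℚ) (a ℓ : Fin n → ℚ) (τ : Fin (suc N) → ℚ)
          (run : Fin N → Fin m → Maybe (Fin n)) → Fin n → ℚ → Set
Pending s a ℓ τ run j t = a j ≤ t × work s τ run j t < ℓ j

IsSSFSchedule : ∀ {n m N} (s : ℚ) (a d ℓ : Fin n → ℚ) (asg : Fin n → Fin m)
                (τ : Fin (suc N) → ℚ) (run : Fin N → Fin m → Maybe (Fin n)) → Set
IsSSFSchedule {n} {m} {N} s a d ℓ asg τ run =
    (∀ (r : Fin N) → lo τ r < hi τ r)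
  × (∀ (x : Fin m) (t : ℚ) (j : Fin n) → RunsAt τ run x t j →
        asg j ≡ x × Pending s a ℓ τ run j t
        × (∀ i → asg i ≡ x → Pending s a ℓ τ run i t → slack a d j ≤ slack a d i))
  × (∀ (x : Fin m) (t : ℚ) → Idle τ run x t →
        ∀ i → asg i ≡ x → ¬ Pending s a ℓ τ run i t)

-- Write R^x − R^y = (U^x − U^y) + (P^y − P^x).  SSF-I sends each class-c request to a machine of
-- least class-c load, so the class-c loads of two machines never differ by more than the largest
-- class-c size 2^(c+1); summing over the classes c ≤ k bounds U^x − U^y by 2^(k+2).  For the second
-- term let t₀ ≤ t be the last time machine x was not running a request of class ≤ k.  Since slack
-- determines class and x runs shortest slack first, at t₀ machine x had finished all of its
-- class-≤k work that arrived before t₀, so P^y(t₀) − P^x(t₀) is at most the difference of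
-- arrived class-≤k loads, again at most 2^(k+2); and on [t₀, t] machine x works at full speed on
-- classes ≤ k, so P^y − P^x cannot grow.

module Submission where

open import Defs
open import Algebra.Bundles using (CommutativeRing)
open import Data.Empty using (⊥; ⊥-elim)
open import Data.Fin as Fin using (Fin; zero; suc; toℕ; inject₁; fromℕ; fromℕ<)
open import Data.Fin.Induction using (<-weakInduction)
import Data.Fin.Properties as Finₚ
open import Data.Integer as ℤ using (ℤ; +_)
import Data.Integer.Properties as ℤₚ
open import Data.Integer.Tactic.RingSolver using (solve-∀)
open import Data.Maybe using (Maybe; just; nothing)
import Data.Maybe.Properties as Maybeₚ
open import Data.Nat as ℕ using (ℕ; zero; suc)
import Data.Nat.Properties as ℕₚ
open import Data.Product using (∃-syntax; _×_; _,_; proj₁; proj₂)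
open import Data.Rational
open import Data.Rational.Properties
open import Data.Rational.Solver using (module +-*-Solver)
open import Data.Sum using (inj₁; inj₂)
open import Function using (_∘_)
open import Level using (Level)
open import Relation.Binary using (tri<; tri≈; tri>)
open import Relation.Binary.PropositionalEquality
open import Relation.Nullary using (Dec; yes; no; ¬_; _×-dec_)

open import Algebra.Properties.Semiring.Sum (CommutativeRing.semiring +-*-commutativeRing)
  using (sum; ∑-distrib-+; ∑-comm; *-distribˡ-sum; *-distribʳ-sum)

open +-*-Solver

private variable
  p q r : ℚ
  ℓ₁ : Level
  P Q : Set ℓ₁

p≤q⇒0≤q-p : p ≤ q → 0ℚ ≤ q - p
p≤q⇒0≤q-p {p} {q} p≤q = subst (_≤ q - p) (+-inverseʳ p) (+-monoˡ-≤ (- p) p≤q)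

p≤q⇒p-q≤0 : p ≤ q → p - q ≤ 0ℚ
p≤q⇒p-q≤0 {p} {q} p≤q = subst (p - q ≤_) (+-inverseʳ q) (+-monoˡ-≤ (- q) p≤q)

p<q⇒0<q-p : p < q → 0ℚ < q - p
p<q⇒0<q-p {p} {q} p<q = subst (_< q - p) (+-inverseʳ p) (+-monoˡ-< (- p) p<q)

-‿mono-≤ : ∀ {p q r s} → p ≤ q → r ≤ s → p - s ≤ q - r
-‿mono-≤ p≤q r≤s = +-mono-≤ p≤q (neg-antimono-≤ r≤s)

0≤p*q : 0ℚ ≤ p → 0ℚ ≤ q → 0ℚ ≤ p * q
0≤p*q {p} {q} 0≤p 0≤q =
  nonNegative⁻¹ (p * q) {{nonNeg*nonNeg⇒nonNeg p {{nonNegative 0≤p}} q {{nonNegative 0≤q}}}}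

*-monoˡ-≤-0≤ : 0ℚ ≤ r → p ≤ q → r * p ≤ r * q
*-monoˡ-≤-0≤ {r} 0≤r = *-monoˡ-≤-nonNeg r {{nonNegative 0≤r}}

p≤r⇒-p≤r⇒∣p∣≤r : p ≤ r → - p ≤ r → ∣ p ∣ ≤ r
p≤r⇒-p≤r⇒∣p∣≤r {p} p≤r -p≤r with ∣p∣≡p∨∣p∣≡-p p
... | inj₁ ∣p∣≡p  = subst (_≤ _) (sym ∣p∣≡p) p≤r
... | inj₂ ∣p∣≡-p = subst (_≤ _) (sym ∣p∣≡-p) -p≤r

i+[j-i]≡j : ∀ i j → i ℤ.+ (j ℤ.- i) ≡ j
i+[j-i]≡j = solve-∀

≤⇒≡+ : ∀ {i j} → i ℤ.≤ j → ∃[ n ] j ≡ i ℤ.+ + n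
≤⇒≡+ {i} {j} i≤j = difference (j ℤ.- i) (ℤₚ.i≤j⇒0≤j-i i≤j) refl
  where
  difference : ∀ z → ℤ.0ℤ ℤ.≤ z → j ℤ.- i ≡ z → ∃[ n ] j ≡ i ℤ.+ + n
  difference (+ n) _ j-i≡n = n , trans (sym (i+[j-i]≡j i j)) (cong (λ z → i ℤ.+ z) j-i≡n)

+-+1 : ∀ i n → i ℤ.+ + n ℤ.+ + 1 ≡ i ℤ.+ + suc n
+-+1 i n = trans (ℤₚ.+-assoc i (+ n) (+ 1)) (cong (λ m → i ℤ.+ + m) (ℕₚ.+-comm n 1))

ℤ-weakInduction-startingFrom : (Q : ℤ → Set) {i : ℤ} → Q i →
  (∀ k → Q k → Q (k ℤ.+ + 1)) → ∀ {j} → i ℤ.≤ j → Q j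
ℤ-weakInduction-startingFrom Q {i} Qi step i≤j with ≤⇒≡+ i≤j
... | n , refl = above n
  where
  above : ∀ n → Q (i ℤ.+ + n)
  above zero    = subst Q (sym (ℤₚ.+-identityʳ i)) Qi
  above (suc n) = subst Q (+-+1 i n) (step _ (above n))

ℤ-weakInduction : (Q : ℤ → Set) (K : ℤ) →
  (∀ k → k ℤ.≤ K → Q k) → (∀ k → Q k → Q (k ℤ.+ + 1)) → ∀ k → Q k
ℤ-weakInduction Q K base step k with k ℤ.≤? K
... | yes k≤K = base k k≤K
... | no  k≰K = ℤ-weakInduction-startingFrom Q (base K ℤₚ.≤-refl) step (ℤₚ.<⇒≤ (ℤₚ.≰⇒> k≰K))

pow2-+1 : ∀ k → pow2 (k ℤ.+ + 1) ≡ pow2 k + pow2 k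
pow2-+1 (+ n)           = trans (cong (pw two) (ℕₚ.+-comm n 1))
  (solve 1 (λ h → (con 1ℚ :+ con 1ℚ) :* h := h :+ h) refl (pw two n))
pow2-+1 ℤ.-[1+ zero ]  = refl
pow2-+1 ℤ.-[1+ suc n ] = solve 1 (λ h → h := con ½ :* h :+ con ½ :* h) refl (pw ½ (suc n))

pw-pos : 0ℚ < q → ∀ n → 0ℚ < pw q n
pw-pos 0<q zero    = positive⁻¹ 1ℚ
pw-pos {q} 0<q (suc n) =
  positive⁻¹ (q * pw q n) {{pos*pos⇒pos q {{positive 0<q}} (pw q n) {{positive (pw-pos 0<q n)}}}}

pow2-pos : ∀ k → 0ℚ < pow2 k
pow2-pos (+ n)      = pw-pos (positive⁻¹ two) n
pow2-pos ℤ.-[1+ n ] = pw-pos (positive⁻¹ ½) (suc n)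

pow2-≤-+1 : ∀ k → pow2 k ≤ pow2 (k ℤ.+ + 1)
pow2-≤-+1 k = begin
  pow2 k            ≡⟨ sym (+-identityʳ (pow2 k)) ⟩
  pow2 k + 0ℚ       ≤⟨ +-monoʳ-≤ (pow2 k) (<⇒≤ (pow2-pos k)) ⟩
  pow2 k + pow2 k   ≡⟨ sym (pow2-+1 k) ⟩
  pow2 (k ℤ.+ + 1)  ∎
  where open ≤-Reasoning

pow2-mono : ∀ {i j} → i ℤ.≤ j → pow2 i ≤ pow2 j
pow2-mono {i} = ℤ-weakInduction-startingFrom (λ j → pow2 i ≤ pow2 j) ≤-refl
  (λ k 2^i≤2^k → ≤-trans 2^i≤2^k (pow2-≤-+1 k))

when-yes : (P? : Dec P) → P → ∀ q → when P? q ≡ q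
when-yes (yes _) _ q = refl
when-yes (no ¬p) p _ = ⊥-elim (¬p p)

when-no : (P? : Dec P) → ¬ P → ∀ q → when P? q ≡ 0ℚ
when-no (yes p) ¬p _ = ⊥-elim (¬p p)
when-no (no _)  _  _ = refl

when-0 : (P? : Dec P) → when P? 0ℚ ≡ 0ℚ
when-0 (yes _) = refl
when-0 (no _)  = refl

when-nonNeg : (P? : Dec P) → 0ℚ ≤ q → 0ℚ ≤ when P? q
when-nonNeg (yes _) 0≤q = 0≤q
when-nonNeg (no _)  _   = ≤-refl

when-≤ : (P? : Dec P) → 0ℚ ≤ q → when P? q ≤ q
when-≤ (yes _) _   = ≤-refl
when-≤ (no _)  0≤q = 0≤q

when-+ : (P? : Dec P) → ∀ q r → when P? (q + r) ≡ when P? q + when P? r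
when-+ (yes _) q r = refl
when-+ (no _)  q r = refl

when-* : (P? : Dec P) → ∀ q r → when P? (q * r) ≡ q * when P? r
when-* (yes _) q r = refl
when-* (no _)  q r = sym (*-zeroʳ q)

when-⇔ : (P? : Dec P) (Q? : Dec Q) →
  (P → Q) → (Q → P) → ∀ q → when P? q ≡ when Q? q
when-⇔ (yes _) (yes _) _   _   q = refl
when-⇔ (yes p) (no ¬q) P→Q _   q = ⊥-elim (¬q (P→Q p))
when-⇔ (no ¬p) (yes q) _   Q→P _ = ⊥-elim (¬p (Q→P q))
when-⇔ (no _)  (no _)  _   _   q = refl

-- Finite sums

sumFin-cong : ∀ {n} {f g : Fin n → ℚ} → (∀ i → f i ≡ g i) → sumFin f ≡ sumFin g
sumFin-cong {zero}  f≗g = refl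
sumFin-cong {suc n} f≗g = cong₂ _+_ (f≗g zero) (sumFin-cong (f≗g ∘ suc))

sumFin-mono : ∀ {n} {f g : Fin n → ℚ} → (∀ i → f i ≤ g i) → sumFin f ≤ sumFin g
sumFin-mono {zero}  f≤g = ≤-refl
sumFin-mono {suc n} f≤g = +-mono-≤ (f≤g zero) (sumFin-mono (f≤g ∘ suc))

sumFin-zero : ∀ {n} {f : Fin n → ℚ} → (∀ i → f i ≡ 0ℚ) → sumFin f ≡ 0ℚ
sumFin-zero {zero}  f≗0 = refl
sumFin-zero {suc n} f≗0 = cong₂ _+_ (f≗0 zero) (sumFin-zero (f≗0 ∘ suc))

sumFin-nonNeg : ∀ {n} {f : Fin n → ℚ} → (∀ i → 0ℚ ≤ f i) → 0ℚ ≤ sumFin f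
sumFin-nonNeg {n} {f} 0≤f = subst (_≤ sumFin f) (sumFin-zero {n} (λ _ → refl)) (sumFin-mono 0≤f)

sumFin≡sum : ∀ {n} (f : Fin n → ℚ) → sumFin f ≡ sum f
sumFin≡sum {zero}  f = refl
sumFin≡sum {suc n} f = cong (_+_ (f zero)) (sumFin≡sum (f ∘ suc))

sumFin-+ : ∀ {n} (f g : Fin n → ℚ) → sumFin (λ i → f i + g i) ≡ sumFin f + sumFin g
sumFin-+ f g = trans (sumFin≡sum (λ i → f i + g i))
  (trans (∑-distrib-+ f g) (sym (cong₂ _+_ (sumFin≡sum f) (sumFin≡sum g))))

sumFin-- : ∀ {n} (f g : Fin n → ℚ) → sumFin (λ i → f i - g i) ≡ sumFin f - sumFin g
sumFin-- {zero}  f g = refl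
sumFin-- {suc n} f g = trans (cong (_+_ (f zero - g zero)) (sumFin-- (f ∘ suc) (g ∘ suc)))
  (solve 4 (λ a b c d → (a :- b) :+ (c :- d) := (a :+ c) :- (b :+ d)) refl (f zero) (g zero) _ _)

sumFin-*ˡ : ∀ {n} q (f : Fin n → ℚ) → sumFin (λ i → q * f i) ≡ q * sumFin f
sumFin-*ˡ q f =
  trans (sumFin≡sum (λ i → q * f i)) (sym (trans (cong (q *_) (sumFin≡sum f)) (*-distribˡ-sum q f)))

sumFin-*ʳ : ∀ {n} q (f : Fin n → ℚ) → sumFin (λ i → f i * q) ≡ sumFin f * q
sumFin-*ʳ q f =
  trans (sumFin≡sum (λ i → f i * q)) (sym (trans (cong (_* q) (sumFin≡sum f)) (*-distribʳ-sum q f)))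

sumFin-comm : ∀ {m n} (f : Fin m → Fin n → ℚ) →
  sumFin (λ i → sumFin (f i)) ≡ sumFin (λ j → sumFin (λ i → f i j))
sumFin-comm f = begin
  sumFin (λ i → sumFin (f i))          ≡⟨ trans (sumFin-cong (λ i → sumFin≡sum (f i)))
                                                (sumFin≡sum (λ i → sum (f i))) ⟩
  sum (λ i → sum (f i))                ≡⟨ ∑-comm f ⟩
  sum (λ j → sum (λ i → f i j))        ≡⟨ sym (trans (sumFin-cong (λ j → sumFin≡sum (λ i → f i j)))
                                                     (sumFin≡sum (λ j → sum (λ i → f i j)))) ⟩
  sumFin (λ j → sumFin (λ i → f i j))  ∎
  where open ≡-Reasoning

sumFin-single : ∀ {n} (f : Fin n → ℚ) i → (∀ j → j ≢ i → f j ≡ 0ℚ) → sumFin f ≡ f i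
sumFin-single {suc n} f zero    f≗0 =
  trans (cong (_+_ (f zero)) (sumFin-zero (λ j → f≗0 (suc j) (λ ())))) (+-identityʳ _)
sumFin-single {suc n} f (suc i) f≗0 =
  trans (cong₂ _+_ (f≗0 zero (λ ()))
                   (sumFin-single (f ∘ suc) i (λ j j≢i → f≗0 (suc j) (j≢i ∘ Finₚ.suc-injective))))
    (+-identityˡ _)

sumFin-agree-except : ∀ {n} (f g : Fin n → ℚ) i → (∀ j → j ≢ i → f j ≡ g j) →
  sumFin f ≡ sumFin g + (f i - g i)
sumFin-agree-except f g i f≗g = begin
  sumFin f                             ≡⟨ solve 2 (λ a b → a := b :+ (a :- b)) refl (sumFin f) (sumFin g) ⟩
  sumFin g + (sumFin f - sumFin g)     ≡⟨ cong (_+_ (sumFin g)) (sym (sumFin-- f g)) ⟩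
  sumFin g + sumFin (λ j → f j - g j)  ≡⟨ cong (_+_ (sumFin g)) (sumFin-single (λ j → f j - g j) i f-g≗0) ⟩
  sumFin g + (f i - g i)               ∎
  where
  open ≡-Reasoning
  f-g≗0 : ∀ j → j ≢ i → f j - g j ≡ 0ℚ
  f-g≗0 j j≢i = trans (cong (_- g j) (f≗g j j≢i)) (+-inverseʳ (g j))

when-sumFin : (P? : Dec P) {n : ℕ} (f : Fin n → ℚ) →
  when P? (sumFin f) ≡ sumFin (λ i → when P? (f i))
when-sumFin (yes _) f = refl
when-sumFin (no _) {n} f = sym (sumFin-zero {n} (λ _ → refl))

-- Piecewise-linear functions over a sequence of breakpoints

Increasing : ∀ {N} → (Fin (suc N) → ℚ) → Set
Increasing {N} τ = ∀ (r : Fin N) → lo τ r < hi τ r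

τ-mono : ∀ {N} (τ : Fin (suc N) → ℚ) → Increasing τ →
  ∀ (i j : Fin (suc N)) → toℕ i ℕ.≤ toℕ j → τ i ≤ τ j
τ-mono         τ inc zero    zero    _           = ≤-refl
τ-mono {suc N} τ inc zero    (suc j) _           =
  ≤-trans (<⇒≤ (inc zero)) (τ-mono (τ ∘ suc) (inc ∘ suc) zero j ℕ.z≤n)
τ-mono {suc N} τ inc (suc i) (suc j) (ℕ.s≤s i≤j) = τ-mono (τ ∘ suc) (inc ∘ suc) i j i≤j

data Position {N} (τ : Fin (suc N) → ℚ) (t : ℚ) : Set where
  before : t < τ zero → Position τ t
  inside : ∀ r → lo τ r ≤ t → t < hi τ r → Position τ t
  after  : τ (fromℕ N) ≤ t → Position τ t

locate : ∀ {N} (τ : Fin (suc N) → ℚ) t → Position τ t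
locate {zero} τ t with t <? τ zero
... | yes t<τ₀ = before t<τ₀
... | no  t≮τ₀ = after (≮⇒≥ t≮τ₀)
locate {suc N} τ t with locate (τ ∘ suc) t
... | inside r lo≤t t<hi = inside (suc r) lo≤t t<hi
... | after τN≤t         = after τN≤t
... | before t<τ₁ with t <? τ zero
...   | yes t<τ₀ = before t<τ₀
...   | no  t≮τ₀ = inside zero (≮⇒≥ t≮τ₀) t<τ₁

module Breakpoints {N : ℕ} (τ : Fin (suc N) → ℚ) (inc : Increasing τ) where

  hi≤lo : ∀ {r r′ : Fin N} → toℕ r ℕ.< toℕ r′ → hi τ r ≤ lo τ r′
  hi≤lo {r} {r′} r<r′ =
    τ-mono τ inc (suc r) (inject₁ r′) (subst (suc (toℕ r) ℕ.≤_) (sym (Finₚ.toℕ-inject₁ r′)) r<r′)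

  τ₀≤lo : ∀ r → τ zero ≤ lo τ r
  τ₀≤lo r = τ-mono τ inc zero (inject₁ r) ℕ.z≤n

  hi≤τN : ∀ r → hi τ r ≤ τ (fromℕ N)
  hi≤τN r = τ-mono τ inc (suc r) (fromℕ N)
    (subst (suc (toℕ r) ℕ.≤_) (sym (Finₚ.toℕ-fromℕ N)) (Finₚ.toℕ<n r))

  interval-unique : ∀ {r r′ t} → lo τ r ≤ t → t < hi τ r → lo τ r′ ≤ t → t < hi τ r′ → r′ ≡ r
  interval-unique {r} {r′} lo≤t t<hi lo′≤t t<hi′ with Finₚ.<-cmp r′ r
  ... | tri< r′<r _ _ = ⊥-elim (<-irrefl refl (<-≤-trans t<hi′ (≤-trans (hi≤lo r′<r) lo≤t)))
  ... | tri≈ _ r′≡r _ = r′≡r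
  ... | tri> _ _ r<r′ = ⊥-elim (<-irrefl refl (<-≤-trans t<hi (≤-trans (hi≤lo r<r′) lo′≤t)))

  lenBefore-nonNeg : ∀ r t → 0ℚ ≤ lenBefore τ r t
  lenBefore-nonNeg r t = p≤p⊔q 0ℚ ((hi τ r ⊓ t) - lo τ r)

  lenBefore-mono : ∀ r {u t} → u ≤ t → lenBefore τ r u ≤ lenBefore τ r t
  lenBefore-mono r u≤t = ⊔-monoʳ-≤ 0ℚ (+-monoˡ-≤ (- lo τ r) (⊓-monoʳ-≤ (hi τ r) u≤t))

  lenBefore-≤lo : ∀ r {t} → t ≤ lo τ r → lenBefore τ r t ≡ 0ℚ
  lenBefore-≤lo r t≤lo = p≥q⇒p⊔q≡p (p≤q⇒p-q≤0 (≤-trans (p⊓q≤q (hi τ r) _) t≤lo))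

  lenBefore-hi≤ : ∀ r {t} → hi τ r ≤ t → lenBefore τ r t ≡ hi τ r - lo τ r
  lenBefore-hi≤ r hi≤t = trans (cong (λ z → 0ℚ ⊔ (z - lo τ r)) (p≤q⇒p⊓q≡p hi≤t))
                                (p≤q⇒p⊔q≡q (p≤q⇒0≤q-p (<⇒≤ (inc r))))

  lenBefore-inside : ∀ r {t} → lo τ r ≤ t → t ≤ hi τ r → lenBefore τ r t ≡ t - lo τ r
  lenBefore-inside r lo≤t t≤hi = trans (cong (λ z → 0ℚ ⊔ (z - lo τ r)) (p≥q⇒p⊓q≡q t≤hi))
                                        (p≤q⇒p⊔q≡q (p≤q⇒0≤q-p lo≤t))

  lenBefore-elsewhere : ∀ r r′ {u t} → r′ ≢ r → lo τ r ≤ u → u ≤ t → t ≤ hi τ r →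
    lenBefore τ r′ t ≡ lenBefore τ r′ u
  lenBefore-elsewhere r r′ r′≢r lo≤u u≤t t≤hi with Finₚ.<-cmp r′ r
  ... | tri< r′<r _ _ = trans (lenBefore-hi≤ r′ (≤-trans (hi≤lo r′<r) (≤-trans lo≤u u≤t)))
                              (sym (lenBefore-hi≤ r′ (≤-trans (hi≤lo r′<r) lo≤u)))
  ... | tri≈ _ r′≡r _ = ⊥-elim (r′≢r r′≡r)
  ... | tri> _ _ r<r′ = trans (lenBefore-≤lo r′ (≤-trans t≤hi (hi≤lo r<r′)))
                              (sym (lenBefore-≤lo r′ (≤-trans (≤-trans u≤t t≤hi) (hi≤lo r<r′))))

  integral : (Fin N → ℚ) → ℚ → ℚ
  integral c t = sumFin (λ r → c r * lenBefore τ r t)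

  integral-affine : ∀ c r {u t} → lo τ r ≤ u → u ≤ t → t ≤ hi τ r →
    integral c t ≡ integral c u + c r * (t - u)
  integral-affine c r {u} {t} lo≤u u≤t t≤hi =
    trans (sumFin-agree-except (λ r′ → c r′ * lenBefore τ r′ t) (λ r′ → c r′ * lenBefore τ r′ u) r
             (λ r′ r′≢r → cong (c r′ *_) (lenBefore-elsewhere r r′ r′≢r lo≤u u≤t t≤hi)))
          (cong (_+_ (integral c u)) increment)
    where
    increment : c r * lenBefore τ r t - c r * lenBefore τ r u ≡ c r * (t - u)
    increment =
      trans (cong₂ (λ z w → c r * z - c r * w) (lenBefore-inside r (≤-trans lo≤u u≤t) t≤hi)
                                               (lenBefore-inside r lo≤u (≤-trans u≤t t≤hi)))
            (solve 4 (λ c t u l → c :* (t :- l) :- c :* (u :- l) := c :* (t :- u)) refl (c r) t u (lo τ r))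

  *-integral-affine : ∀ q c r {u t} → lo τ r ≤ u → u ≤ t → t ≤ hi τ r →
    q * integral c t ≡ q * integral c u + (q * c r) * (t - u)
  *-integral-affine q c r lo≤u u≤t t≤hi =
    trans (cong (q *_) (integral-affine c r lo≤u u≤t t≤hi))
          (solve 4 (λ q f c d → q :* (f :+ c :* d) := q :* f :+ (q :* c) :* d) refl q (integral c _) (c r) _)

  integral-mono : ∀ c → (∀ r → 0ℚ ≤ c r) → ∀ {u t} → u ≤ t → integral c u ≤ integral c t
  integral-mono c 0≤c u≤t = sumFin-mono (λ r → *-monoˡ-≤-0≤ (0≤c r) (lenBefore-mono r u≤t))

  integral-before : ∀ c {t} → t ≤ τ zero → integral c t ≡ 0ℚ
  integral-before c t≤τ₀ =
    sumFin-zero (λ r → trans (cong (c r *_) (lenBefore-≤lo r (≤-trans t≤τ₀ (τ₀≤lo r))))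
                             (*-zeroʳ (c r)))

  integral-after : ∀ c {t} → τ (fromℕ N) ≤ t → integral c t ≡ integral c (τ (fromℕ N))
  integral-after c τN≤t = sumFin-cong (λ r → cong (c r *_)
    (trans (lenBefore-hi≤ r (≤-trans (hi≤τN r) τN≤t)) (sym (lenBefore-hi≤ r (hi≤τN r)))))

close-to-right-end : ∀ {p q c e} → p < q → 0ℚ ≤ c → 0ℚ < e →
  ∃[ u ] p ≤ u × u < q × c * (q - u) ≤ e
close-to-right-end {p} {q} {c} {e} p<q 0≤c 0<e with c ≤? 0ℚ
... | yes c≤0 = p , ≤-refl , p<q ,
  subst (_≤ e) (sym (trans (cong (_* (q - p)) (≤-antisym c≤0 0≤c)) (*-zeroˡ (q - p)))) (<⇒≤ 0<e)
... | no  c≰0 = q - δ , p≤q-δ , q-δ<q , c*δ≤e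
  where
  instance
    c-pos : Positive c
    c-pos = positive (≰⇒> c≰0)
    c-nonZero : NonZero c
    c-nonZero = pos⇒nonZero c
    e-pos : Positive e
    e-pos = positive 0<e
    1/c-pos : Positive (1/ c)
    1/c-pos = 1/pos⇒pos c
  δ : ℚ
  δ = (q - p) ⊓ (e * 1/ c)
  0<δ : 0ℚ < δ
  0<δ with ⊓-sel (q - p) (e * 1/ c)
  ... | inj₁ δ≡q-p = subst (0ℚ <_) (sym δ≡q-p) (p<q⇒0<q-p p<q)
  ... | inj₂ δ≡e/c = subst (0ℚ <_) (sym δ≡e/c) (positive⁻¹ (e * 1/ c) {{pos*pos⇒pos e (1/ c)}})
  p≤q-δ : p ≤ q - δ
  p≤q-δ = subst (_≤ q - δ) (solve 2 (λ p q → q :- (q :- p) := p) refl p q)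
    (+-monoʳ-≤ q (neg-antimono-≤ (p⊓q≤p (q - p) (e * 1/ c))))
  q-δ<q : q - δ < q
  q-δ<q = subst (q - δ <_) (+-identityʳ q) (+-monoʳ-< q (neg-antimono-< 0<δ))
  c*δ≤e : c * (q - (q - δ)) ≤ e
  c*δ≤e = begin
    c * (q - (q - δ))  ≡⟨ cong (c *_) (solve 2 (λ q d → q :- (q :- d) := d) refl q δ) ⟩
    c * δ              ≤⟨ *-monoˡ-≤-0≤ 0≤c (p⊓q≤q (q - p) (e * 1/ c)) ⟩
    c * (e * 1/ c)     ≡⟨ solve 3 (λ c e i → c :* (e :* i) := e :* (c :* i)) refl c e (1/ c) ⟩
    e * (c * 1/ c)     ≡⟨ trans (cong (e *_) (*-inverseʳ c)) (*-identityʳ e) ⟩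
    e                  ∎
    where open ≤-Reasoning

affine-≤-at-right-end : ∀ (f : ℚ → ℚ) {p q c L} → p < q → 0ℚ ≤ c →
  (∀ u → p ≤ u → u ≤ q → f q ≡ f u + c * (q - u)) →
  (∀ u → p ≤ u → u < q → f u < L) → f q ≤ L
affine-≤-at-right-end f {p} {q} {c} {L} p<q 0≤c affine below with f q ≤? L
... | yes fq≤L = fq≤L
... | no  fq≰L with close-to-right-end p<q 0≤c (p<q⇒0<q-p (≰⇒> fq≰L))
...   | u , p≤u , u<q , c[q-u]≤fq-L = ⊥-elim (<-irrefl refl (begin-strict
  f q                ≡⟨ affine u p≤u (<⇒≤ u<q) ⟩
  f u + c * (q - u)  ≤⟨ +-monoʳ-≤ (f u) c[q-u]≤fq-L ⟩
  f u + (f q - L)    <⟨ +-monoˡ-< (f q - L) (below u p≤u u<q) ⟩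
  L + (f q - L)      ≡⟨ solve 2 (λ l g → l :+ (g :- l) := g) refl L (f q) ⟩
  f q                ∎))
  where open ≤-Reasoning

-- Greedy balancing of class loads

prefixSum : ∀ {n} → ℕ → (Fin n → ℚ) → ℚ
prefixSum p f = sumFin (λ j → when (toℕ j ℕ.<? p) (f j))

prefixSum-zero : ∀ {n} (f : Fin n → ℚ) → prefixSum 0 f ≡ 0ℚ
prefixSum-zero f = sumFin-zero (λ j → when-no (toℕ j ℕ.<? 0) (λ ()) (f j))

prefixSum-all : ∀ {n} (f : Fin n → ℚ) → prefixSum n f ≡ sumFin f
prefixSum-all f = sumFin-cong (λ j → when-yes (toℕ j ℕ.<? _) (Finₚ.toℕ<n j) (f j))

prefixSum-suc : ∀ {n p} (f : Fin n → ℚ) (p<n : p ℕ.< n) →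
  prefixSum (suc p) f ≡ prefixSum p f + f (fromℕ< p<n)
prefixSum-suc {n} {p} f p<n =
  trans (sumFin-agree-except (λ i → when (toℕ i ℕ.<? suc p) (f i)) (λ i → when (toℕ i ℕ.<? p) (f i)) j
           (λ i i≢j → when-⇔ (toℕ i ℕ.<? suc p) (toℕ i ℕ.<? p) (i<1+p⇒i<p i≢j) ℕₚ.m<n⇒m<1+n (f i)))
        (cong (_+_ (prefixSum p f)) newcomer)
  where
  j : Fin n
  j = fromℕ< p<n
  toℕj≡p : toℕ j ≡ p
  toℕj≡p = Finₚ.toℕ-fromℕ< p<n
  i<1+p⇒i<p : ∀ {i} → i ≢ j → toℕ i ℕ.< suc p → toℕ i ℕ.< p
  i<1+p⇒i<p i≢j i<1+p =
    ℕₚ.≤∧≢⇒< (ℕ.s≤s⁻¹ i<1+p) (λ i≡p → i≢j (Finₚ.toℕ-injective (trans i≡p (sym toℕj≡p))))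
  newcomer : when (toℕ j ℕ.<? suc p) (f j) - when (toℕ j ℕ.<? p) (f j) ≡ f j
  newcomer = trans
    (cong₂ _-_ (when-yes (toℕ j ℕ.<? suc p) (ℕ.s≤s (ℕₚ.≤-reflexive toℕj≡p)) (f j))
               (when-no (toℕ j ℕ.<? p) (λ j<p → ℕₚ.<-irrefl toℕj≡p j<p) (f j)))
    (solve 1 (λ a → a :- con 0ℚ := a) refl (f j))

Balanced : ∀ {m} → ℚ → (Fin m → ℚ) → Set
Balanced b A = ∀ x y → A x - A y ≤ b

balanced-cong : ∀ {m b} {A B : Fin m → ℚ} → (∀ z → A z ≡ B z) → Balanced b A → Balanced b B
balanced-cong A≗B bal x y = subst₂ (λ u v → u - v ≤ _) (A≗B x) (A≗B y) (bal x y)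

balanced-0 : ∀ {m b} → 0ℚ ≤ b → Balanced {m} b (λ _ → 0ℚ)
balanced-0 {b = b} 0≤b _ _ = subst (_≤ b) (sym (+-inverseʳ 0ℚ)) 0≤b

balanced-+ : ∀ {m b b′} {A B : Fin m → ℚ} → Balanced b A → Balanced b′ B →
  Balanced (b + b′) (λ z → A z + B z)
balanced-+ {A = A} {B} balA balB x y =
  subst (_≤ _) (solve 4 (λ a b c d → (a :- c) :+ (b :- d) := (a :+ b) :- (c :+ d)) refl (A x) (B x) (A y) (B y))
    (+-mono-≤ (balA x y) (balB x y))

balanced-+-at-min : ∀ {m b} {A : Fin m → ℚ} {w l} → Balanced b A → (∀ z → A w ≤ A z) →
  0ℚ ≤ l → l ≤ b → Balanced b (λ z → A z + when (w Finₚ.≟ z) l)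
balanced-+-at-min {A = A} {w} {l} bal w-min 0≤l l≤b x y with w Finₚ.≟ x | w Finₚ.≟ y
... | yes _    | yes _    =
  subst (_≤ _) (solve 3 (λ a b l → a :- b := (a :+ l) :- (b :+ l)) refl (A x) (A y) l) (bal x y)
... | no _     | no _     =
  subst (_≤ _) (solve 2 (λ a b → a :- b := (a :+ con 0ℚ) :- (b :+ con 0ℚ)) refl (A x) (A y)) (bal x y)
... | yes refl | no _     = begin
  (A w + l) - (A y + 0ℚ)
    ≡⟨ solve 3 (λ a b l → (a :+ l) :- (b :+ con 0ℚ) := l :+ (a :- b)) refl (A w) (A y) l ⟩
  l + (A w - A y)         ≤⟨ +-monoʳ-≤ l (p≤q⇒p-q≤0 (w-min y)) ⟩
  l + 0ℚ                  ≡⟨ +-identityʳ l ⟩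
  l                       ≤⟨ l≤b ⟩
  _                       ∎
  where open ≤-Reasoning
... | no _     | yes refl = begin
  (A x + 0ℚ) - (A w + l)
    ≡⟨ solve 3 (λ a b l → (a :+ con 0ℚ) :- (b :+ l) := (a :- b) :- l) refl (A x) (A w) l ⟩
  (A x - A w) - l         ≤⟨ +-monoʳ-≤ (A x - A w) (neg-antimono-≤ 0≤l) ⟩
  (A x - A w) - 0ℚ        ≡⟨ +-identityʳ (A x - A w) ⟩
  A x - A w               ≤⟨ bal x w ⟩
  _                       ∎
  where open ≤-Reasoning

strict-lower-bound : ∀ {n} (f : Fin n → ℤ) → ∃[ K ] ∀ j → K ℤ.< f j
strict-lower-bound {zero}  f = ℤ.0ℤ , λ ()
strict-lower-bound {suc n} f with strict-lower-bound (f ∘ suc)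
... | K , K<f = K ℤ.⊓ ℤ.pred (f zero) , below
  where
  below : ∀ j → K ℤ.⊓ ℤ.pred (f zero) ℤ.< f j
  below zero    = ℤₚ.≤-<-trans (ℤₚ.i⊓j≤j K _) (ℤₚ.i≤pred[j]⇒i<j ℤₚ.≤-refl)
  below (suc j) = ℤₚ.≤-<-trans (ℤₚ.i⊓j≤i K _) (K<f j)

i<j⇒i+1≤j : ∀ {i j} → i ℤ.< j → i ℤ.+ + 1 ℤ.≤ j
i<j⇒i+1≤j {i} i<j = subst (ℤ._≤ _) (ℤₚ.+-comm (+ 1) i) (ℤₚ.i<j⇒suc[i]≤j i<j)

i≤j⇒i<j+1 : ∀ {i j} → i ℤ.≤ j → i ℤ.< j ℤ.+ + 1
i≤j⇒i<j+1 {i} {j} i≤j =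
  ℤₚ.suc[i]≤j⇒i<j (subst (ℤ.suc i ℤ.≤_) (ℤₚ.+-comm (+ 1) j) (ℤₚ.suc-mono i≤j))

when-≤-+1 : ∀ c k q → when (c ℤₚ.≤? k ℤ.+ + 1) q ≡ when (c ℤₚ.≤? k) q + when (c ℤₚ.≟ k ℤ.+ + 1) q
when-≤-+1 c k q with c ℤₚ.≤? k | c ℤₚ.≟ k ℤ.+ + 1
... | yes c≤k | yes c≡k+1 = ⊥-elim (ℤₚ.<-irrefl c≡k+1 (i≤j⇒i<j+1 c≤k))
... | yes c≤k | no _      =
  trans (when-yes (c ℤₚ.≤? k ℤ.+ + 1) (ℤₚ.<⇒≤ (i≤j⇒i<j+1 c≤k)) q) (sym (+-identityʳ q))
... | no _    | yes refl  = trans (when-yes (c ℤₚ.≤? k ℤ.+ + 1) ℤₚ.≤-refl q) (sym (+-identityˡ q))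
... | no c≰k  | no c≢k+1  = when-no (c ℤₚ.≤? k ℤ.+ + 1)
  (λ c≤k+1 → c≢k+1 (ℤₚ.≤-antisym c≤k+1 (i<j⇒i+1≤j (ℤₚ.≰⇒> c≰k)))) q

module Loads {n m : ℕ} (ℓ : Fin n → ℚ) (cls : Fin n → ℤ) (asg : Fin n → Fin m)
  (0≤ℓ : ∀ j → 0ℚ ≤ ℓ j) (ℓ≤2^[cls+1] : ∀ j → ℓ j ≤ pow2 (cls j ℤ.+ + 1))
  (ssf-i : SSF-I-Assignment ℓ cls asg)
  {F : Fin n → Set} (F? : ∀ j → Dec (F j)) (F-prefix : ∀ i j → toℕ i ℕ.< toℕ j → F j → F i) where

  counted : Fin m → Fin n → ℚ → ℚ
  counted x j q = when (F? j) (when (asg j Finₚ.≟ x) q)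

  counted-+ : ∀ x j q r → counted x j (q + r) ≡ counted x j q + counted x j r
  counted-+ x j q r = trans (cong (when (F? j)) (when-+ (asg j Finₚ.≟ x) q r)) (when-+ (F? j) _ _)

  counted-0 : ∀ x j → counted x j 0ℚ ≡ 0ℚ
  counted-0 x j = trans (cong (when (F? j)) (when-0 (asg j Finₚ.≟ x))) (when-0 (F? j))

  share : Fin m → ℤ → Fin n → ℚ
  share x c j = counted x j (when (cls j ℤₚ.≟ c) (ℓ j))

  prefixSum-share≡loadBefore : ∀ {p} (p<n : p ℕ.< n) x → F (fromℕ< p<n) →
    prefixSum p (share x (cls (fromℕ< p<n))) ≡ loadBefore ℓ cls asg x (cls (fromℕ< p<n)) (fromℕ< p<n)
  prefixSum-share≡loadBefore {p} p<n x Fj = sumFin-cong same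
    where
    j : Fin n
    j = fromℕ< p<n
    i<p⇒i<j : ∀ {i} → toℕ i ℕ.< p → i Fin.< j
    i<p⇒i<j = subst (_ ℕ.<_) (sym (Finₚ.toℕ-fromℕ< p<n))
    assigned : Fin n → ℚ
    assigned i = when (asg i Finₚ.≟ x) (when (cls i ℤₚ.≟ cls j) (ℓ i))
    same : ∀ i → when (toℕ i ℕ.<? p) (when (F? i) (assigned i)) ≡ when (i Finₚ.<? j) (assigned i)
    same i with toℕ i ℕ.<? p
    ... | yes i<p = trans (when-yes (F? i) (F-prefix i j (i<p⇒i<j i<p) Fj) (assigned i))
                          (sym (when-yes (i Finₚ.<? j) (i<p⇒i<j i<p) (assigned i)))
    ... | no  i≮p =
      sym (when-no (i Finₚ.<? j) (λ i<j → i≮p (subst (_ ℕ.<_) (Finₚ.toℕ-fromℕ< p<n) i<j)) (assigned i))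

  share-counted : ∀ j → F j → ∀ x → share x (cls j) j ≡ when (asg j Finₚ.≟ x) (ℓ j)
  share-counted j Fj x = trans (when-yes (F? j) Fj _)
    (cong (when (asg j Finₚ.≟ x)) (when-yes (cls j ℤₚ.≟ cls j) refl (ℓ j)))

  share-uncounted : ∀ j c → ¬ (F j × cls j ≡ c) → ∀ x → share x c j ≡ 0ℚ
  share-uncounted j c uncounted x with F? j | cls j ℤₚ.≟ c
  ... | no _   | _       = refl
  ... | yes Fj | yes c≡ = ⊥-elim (uncounted (Fj , c≡))
  ... | yes _  | no _    = when-0 (asg j Finₚ.≟ x)

  prefix-balanced : ∀ p → p ℕ.≤ n → ∀ c → Balanced (pow2 (c ℤ.+ + 1)) (λ x → prefixSum p (share x c))
  prefix-balanced zero _ c =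
    balanced-cong (λ x → sym (prefixSum-zero (share x c))) (balanced-0 (<⇒≤ (pow2-pos (c ℤ.+ + 1))))
  prefix-balanced (suc p) p<n c = balanced-cong (λ z → sym (prefixSum-suc (share z c) p<n)) extended
    where
    j : Fin n
    j = fromℕ< p<n
    old : Fin m → ℚ
    old z = prefixSum p (share z c)
    extended : Balanced (pow2 (c ℤ.+ + 1)) (λ z → old z + share z c j)
    extended with F? j ×-dec (cls j ℤₚ.≟ c)
    ... | yes (Fj , refl) = balanced-cong (λ z → cong (_+_ (old z)) (sym (share-counted j Fj z)))
      (balanced-+-at-min (prefix-balanced p (ℕₚ.<⇒≤ p<n) c) least (0≤ℓ j) (ℓ≤2^[cls+1] j))
      where
      least : ∀ z → old (asg j) ≤ old z
      least z = subst₂ _≤_ (sym (prefixSum-share≡loadBefore p<n (asg j) Fj))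
                           (sym (prefixSum-share≡loadBefore p<n z Fj)) (ssf-i j z)
    ... | no uncounted = balanced-cong
      (λ z → sym (trans (cong (_+_ (old z)) (share-uncounted j c uncounted z)) (+-identityʳ (old z))))
      (prefix-balanced p (ℕₚ.<⇒≤ p<n) c)

  classLoad : Fin m → ℤ → ℚ
  classLoad x c = sumFin (share x c)

  classLoad-balanced : ∀ c → Balanced (pow2 (c ℤ.+ + 1)) (λ x → classLoad x c)
  classLoad-balanced c = balanced-cong (λ x → prefixSum-all (share x c)) (prefix-balanced n ℕₚ.≤-refl c)

  load≤ : Fin m → ℤ → ℚ
  load≤ x k = sumFin (λ j → counted x j (when (cls j ℤₚ.≤? k) (ℓ j)))

  load≤-+1 : ∀ x k → load≤ x (k ℤ.+ + 1) ≡ load≤ x k + classLoad x (k ℤ.+ + 1)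
  load≤-+1 x k =
    trans (sumFin-cong split)
          (sumFin-+ (λ j → counted x j (when (cls j ℤₚ.≤? k) (ℓ j))) (share x (k ℤ.+ + 1)))
    where
    split : ∀ j → counted x j (when (cls j ℤₚ.≤? k ℤ.+ + 1) (ℓ j))
                ≡ counted x j (when (cls j ℤₚ.≤? k) (ℓ j)) + share x (k ℤ.+ + 1) j
    split j = trans (cong (counted x j) (when-≤-+1 (cls j) k (ℓ j))) (counted-+ x j _ _)

  load≤-below-classes : ∀ x k → (∀ j → k ℤ.< cls j) → load≤ x k ≡ 0ℚ
  load≤-below-classes x k k<cls = sumFin-zero (λ j →
    trans (cong (counted x j) (when-no (cls j ℤₚ.≤? k) (ℤₚ.<⇒≱ (k<cls j)) (ℓ j))) (counted-0 x j))

  load≤-balanced : ∀ k → Balanced (pow2 (k ℤ.+ + 2)) (λ x → load≤ x k)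
  load≤-balanced with strict-lower-bound cls
  ... | K , K<cls = ℤ-weakInduction (λ k → Balanced (pow2 (k ℤ.+ + 2)) (λ x → load≤ x k)) K base step
    where
    base : ∀ k → k ℤ.≤ K → Balanced (pow2 (k ℤ.+ + 2)) (λ x → load≤ x k)
    base k k≤K = balanced-cong (λ x → sym (load≤-below-classes x k (λ j → ℤₚ.≤-<-trans k≤K (K<cls j))))
      (balanced-0 (<⇒≤ (pow2-pos (k ℤ.+ + 2))))
    step : ∀ k → Balanced (pow2 (k ℤ.+ + 2)) (λ x → load≤ x k) →
      Balanced (pow2 (k ℤ.+ + 1 ℤ.+ + 2)) (λ x → load≤ x (k ℤ.+ + 1))
    step k bal = subst (λ b → Balanced b (λ x → load≤ x (k ℤ.+ + 1))) 2^[k+2]+2^[k+2]≡2^[k+3]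
      (balanced-cong (λ x → sym (load≤-+1 x k))
        (balanced-+ {A = λ x → load≤ x k} {B = λ x → classLoad x (k ℤ.+ + 1)}
                    bal (classLoad-balanced (k ℤ.+ + 1))))
      where
      2^[k+2]+2^[k+2]≡2^[k+3] : pow2 (k ℤ.+ + 2) + pow2 (k ℤ.+ + 1 ℤ.+ + 1) ≡ pow2 (k ℤ.+ + 1 ℤ.+ + 2)
      2^[k+2]+2^[k+2]≡2^[k+3] = begin
        pow2 (k ℤ.+ + 2) + pow2 (k ℤ.+ + 1 ℤ.+ + 1)
          ≡⟨ cong (λ e → pow2 (k ℤ.+ + 2) + pow2 e) (ℤₚ.+-assoc k (+ 1) (+ 1)) ⟩
        pow2 (k ℤ.+ + 2) + pow2 (k ℤ.+ + 2)
          ≡⟨ sym (pow2-+1 (k ℤ.+ + 2)) ⟩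
        pow2 (k ℤ.+ + 2 ℤ.+ + 1)
          ≡⟨ cong pow2 (trans (ℤₚ.+-assoc k (+ 2) (+ 1)) (sym (ℤₚ.+-assoc k (+ 1) (+ 2)))) ⟩
        pow2 (k ℤ.+ + 1 ℤ.+ + 2) ∎
        where open ≡-Reasoning

-- Work done under a shortest-slack-first schedule

module Schedule {n m N : ℕ} (s : ℚ) (0≤s : 0ℚ ≤ s) (a d ℓ : Fin n → ℚ) (0≤ℓ : ∀ j → 0ℚ ≤ ℓ j)
  (asg : Fin n → Fin m) (τ : Fin (suc N) → ℚ) (run : Fin N → Fin m → Maybe (Fin n))
  (ssf : IsSSFSchedule s a d ℓ asg τ run) where

  open Breakpoints τ (proj₁ ssf)

  runs-assigned-pending : ∀ {r x j} → run r x ≡ just j → asg j ≡ x × Pending s a ℓ τ run j (lo τ r)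
  runs-assigned-pending {r} {x} {j} runs =
    let assigned , pending , _ = proj₁ (proj₂ ssf) x (lo τ r) j (r , ≤-refl , proj₁ ssf r , runs)
    in assigned , pending

  runsOn : Maybe (Fin n) → Fin n → ℚ
  runsOn nothing  j = 0ℚ
  runsOn (just i) j = when (i Finₚ.≟ j) 1ℚ

  runsJob≡runsOn* : ∀ o j q → runsJob o j q ≡ runsOn o j * q
  runsJob≡runsOn* nothing  j q = sym (*-zeroˡ q)
  runsJob≡runsOn* (just i) j q with i Finₚ.≟ j
  ... | yes _ = sym (*-identityˡ q)
  ... | no _  = sym (*-zeroˡ q)

  jobRate : Fin n → Fin N → ℚ
  jobRate j r = sumFin (λ x → runsOn (run r x) j)

  jobRate-nonNeg : ∀ j r → 0ℚ ≤ jobRate j r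
  jobRate-nonNeg j r = sumFin-nonNeg (λ x → runsOn-nonNeg (run r x))
    where
    runsOn-nonNeg : ∀ o → 0ℚ ≤ runsOn o j
    runsOn-nonNeg nothing  = ≤-refl
    runsOn-nonNeg (just i) = when-nonNeg (i Finₚ.≟ j) (nonNegative⁻¹ 1ℚ)

  done : Fin n → ℚ → ℚ
  done = work s τ run

  done≡integral : ∀ j t → done j t ≡ s * integral (jobRate j) t
  done≡integral j t = cong (s *_) (sumFin-cong (λ r →
    trans (sumFin-cong (λ x → runsJob≡runsOn* (run r x) j (lenBefore τ r t)))
          (sumFin-*ʳ (lenBefore τ r t) (λ x → runsOn (run r x) j))))

  done-nonNeg : ∀ j t → 0ℚ ≤ done j t
  done-nonNeg j t = subst (0ℚ ≤_) (sym (done≡integral j t))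
    (0≤p*q 0≤s (sumFin-nonNeg (λ r → 0≤p*q (jobRate-nonNeg j r) (lenBefore-nonNeg r t))))

  done-mono : ∀ j {u t} → u ≤ t → done j u ≤ done j t
  done-mono j {u} {t} u≤t = subst₂ _≤_ (sym (done≡integral j u)) (sym (done≡integral j t))
    (*-monoˡ-≤-0≤ 0≤s (integral-mono (jobRate j) (jobRate-nonNeg j) u≤t))

  done-affine : ∀ j r {u t} → lo τ r ≤ u → u ≤ t → t ≤ hi τ r →
    done j t ≡ done j u + (s * jobRate j r) * (t - u)
  done-affine j r {u} {t} lo≤u u≤t t≤hi =
    trans (done≡integral j t) (trans (*-integral-affine s (jobRate j) r lo≤u u≤t t≤hi)
      (cong (_+ (s * jobRate j r) * (t - u)) (sym (done≡integral j u))))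

  done-before-arrival : ∀ j {t} → t ≤ a j → done j t ≡ 0ℚ
  done-before-arrival j {t} t≤a =
    trans (cong (s *_) (sumFin-zero (λ r → sumFin-zero (λ x → unstarted r x)))) (*-zeroʳ s)
    where
    unstarted : ∀ r x → runsJob (run r x) j (lenBefore τ r t) ≡ 0ℚ
    unstarted r x with run r x in runs
    ... | nothing = refl
    ... | just i with i Finₚ.≟ j
    ...   | no _     = refl
    ...   | yes refl = lenBefore-≤lo r (≤-trans t≤a (proj₁ (proj₂ (runs-assigned-pending runs))))

  done-at-hi : ∀ j r → done j (lo τ r) ≤ ℓ j → done j (hi τ r) ≤ ℓ j
  done-at-hi j r done[lo]≤ℓ with Finₚ.any? (λ x → Maybeₚ.≡-dec Finₚ._≟_ (run r x) (just j))
  ... | yes (x , runs) = affine-≤-at-right-end (done j) (proj₁ ssf r) (0≤p*q 0≤s (jobRate-nonNeg j r))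
    (λ u lo≤u u≤hi → done-affine j r lo≤u u≤hi ≤-refl)
    (λ u lo≤u u<hi → proj₂ (proj₁ (proj₂ (proj₁ (proj₂ ssf) x u j (r , lo≤u , u<hi , runs)))))
  ... | no nobody = subst (_≤ ℓ j) (sym done[hi]≡done[lo]) done[lo]≤ℓ
    where
    rate≡0 : jobRate j r ≡ 0ℚ
    rate≡0 = sumFin-zero idle
      where
      idle : ∀ x → runsOn (run r x) j ≡ 0ℚ
      idle x with run r x in runs
      ... | nothing = refl
      ... | just i with i Finₚ.≟ j
      ...   | no _     = refl
      ...   | yes refl = ⊥-elim (nobody (x , runs))
    done[hi]≡done[lo] : done j (hi τ r) ≡ done j (lo τ r)
    done[hi]≡done[lo] = trans (done-affine j r ≤-refl (<⇒≤ (proj₁ ssf r)) ≤-refl)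
      (trans (cong (λ c → done j (lo τ r) + (s * c) * (hi τ r - lo τ r)) rate≡0)
        (solve 3 (λ w s e → w :+ (s :* con 0ℚ) :* e := w) refl (done j (lo τ r)) s (hi τ r - lo τ r)))

  done-at-breakpoint : ∀ j v → done j (τ v) ≤ ℓ j
  done-at-breakpoint j = <-weakInduction (λ v → done j (τ v) ≤ ℓ j)
    (subst (_≤ ℓ j) (sym (done-at-τ₀)) (0≤ℓ j)) (done-at-hi j)
    where
    done-at-τ₀ : done j (τ zero) ≡ 0ℚ
    done-at-τ₀ = trans (done≡integral j (τ zero))
                       (trans (cong (s *_) (integral-before (jobRate j) ≤-refl)) (*-zeroʳ s))

  done-≤-size : ∀ j t → done j t ≤ ℓ j
  done-≤-size j t = begin
    done j t                                  ≤⟨ done-mono j (p≤p⊔q t τN) ⟩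
    done j (t ⊔ τN)                           ≡⟨ done≡integral j (t ⊔ τN) ⟩
    s * integral (jobRate j) (t ⊔ τN)         ≡⟨ cong (s *_) (integral-after (jobRate j) (p≤q⊔p t τN)) ⟩
    s * integral (jobRate j) τN               ≡⟨ sym (done≡integral j τN) ⟩
    done j τN                                 ≤⟨ done-at-breakpoint j (fromℕ N) ⟩
    ℓ j                                       ∎
    where
    open ≤-Reasoning
    τN : ℚ
    τN = τ (fromℕ N)

  module UpToClass (cls : Fin n → ℤ) (k : ℤ) where

    Pk : Fin m → ℚ → ℚ
    Pk x = P≤ s cls τ run x k

    counts : Fin m → Fin n → ℚ → ℚ
    counts x j q = when (asg j Finₚ.≟ x) (when (cls j ℤₚ.≤? k) q)

    counts-sumFin : ∀ x j {p} (f : Fin p → ℚ) → counts x j (sumFin f) ≡ sumFin (λ i → counts x j (f i))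
    counts-sumFin x j f = trans (cong (when (asg j Finₚ.≟ x)) (when-sumFin (cls j ℤₚ.≤? k) f))
                                (when-sumFin (asg j Finₚ.≟ x) (λ i → when (cls j ℤₚ.≤? k) (f i)))

    counts-0 : ∀ x j → counts x j 0ℚ ≡ 0ℚ
    counts-0 x j = trans (cong (when (asg j Finₚ.≟ x)) (when-0 (cls j ℤₚ.≤? k))) (when-0 (asg j Finₚ.≟ x))

    counts-* : ∀ x j q r → counts x j (q * r) ≡ q * counts x j r
    counts-* x j q r = trans (cong (when (asg j Finₚ.≟ x)) (when-* (cls j ℤₚ.≤? k) q r))
                             (when-* (asg j Finₚ.≟ x) q _)

    slot-counted : ∀ x r w q →
      sumFin (λ j → counts x j (runsJob (run r w) j q)) ≡ when (w Finₚ.≟ x) (runsLe cls k (run r w) q)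
    slot-counted x r w q with run r w in runs
    ... | nothing = trans (sumFin-zero (counts-0 x)) (sym (when-0 (w Finₚ.≟ x)))
    ... | just i = begin
      sumFin (λ j → counts x j (when (i Finₚ.≟ j) q))  ≡⟨ sumFin-single _ i elsewhere ⟩
      counts x i (when (i Finₚ.≟ i) q)                ≡⟨ cong (counts x i) (when-yes (i Finₚ.≟ i) refl q) ⟩
      counts x i q                                    ≡⟨ cong (λ z → when (z Finₚ.≟ x) (when (cls i ℤₚ.≤? k) q))
                                                             (proj₁ (runs-assigned-pending runs)) ⟩
      when (w Finₚ.≟ x) (when (cls i ℤₚ.≤? k) q)      ∎
      where
      open ≡-Reasoning
      elsewhere : ∀ j → j ≢ i → counts x j (when (i Finₚ.≟ j) q) ≡ 0ℚ
      elsewhere j j≢i = trans (cong (counts x j) (when-no (i Finₚ.≟ j) (j≢i ∘ sym) q)) (counts-0 x j)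

    machine-total : ∀ x r q →
      sumFin (λ w → sumFin (λ j → counts x j (runsJob (run r w) j q))) ≡ runsLe cls k (run r x) q
    machine-total x r q = trans (sumFin-cong (λ w → slot-counted x r w q))
      (trans (sumFin-single (λ w → when (w Finₚ.≟ x) (runsLe cls k (run r w) q)) x
                            (λ w w≢x → when-no (w Finₚ.≟ x) w≢x (runsLe cls k (run r w) q)))
             (when-yes (x Finₚ.≟ x) refl (runsLe cls k (run r x) q)))

    Pk≡sum-of-done : ∀ x t → Pk x t ≡ sumFin (λ j → counts x j (done j t))
    Pk≡sum-of-done x t = sym (begin
      sumFin (λ j → counts x j (s * sumFin (λ r → sumFin (λ w → R r w j))))
        ≡⟨ sumFin-cong (λ j → counts-* x j s _) ⟩
      sumFin (λ j → s * counts x j (sumFin (λ r → sumFin (λ w → R r w j))))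
        ≡⟨ sumFin-*ˡ s (λ j → counts x j (sumFin (λ r → sumFin (λ w → R r w j)))) ⟩
      s * sumFin (λ j → counts x j (sumFin (λ r → sumFin (λ w → R r w j))))
        ≡⟨ cong (s *_) (sumFin-cong (λ j → trans (counts-sumFin x j (λ r → sumFin (λ w → R r w j)))
             (sumFin-cong (λ r → counts-sumFin x j (λ w → R r w j))))) ⟩
      s * sumFin (λ j → sumFin (λ r → sumFin (λ w → counts x j (R r w j))))
        ≡⟨ cong (s *_) (trans (sumFin-comm (λ j r → sumFin (λ w → counts x j (R r w j))))
                              (sumFin-cong (λ r → sumFin-comm (λ j w → counts x j (R r w j))))) ⟩
      s * sumFin (λ r → sumFin (λ w → sumFin (λ j → counts x j (R r w j))))
        ≡⟨ cong (s *_) (sumFin-cong (λ r → machine-total x r (lenBefore τ r t))) ⟩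
      s * sumFin (λ r → runsLe cls k (run r x) (lenBefore τ r t)) ∎)
      where
      open ≡-Reasoning
      R : Fin N → Fin m → Fin n → ℚ
      R r w j = runsJob (run r w) j (lenBefore τ r t)

    counts-nonNeg : ∀ x j {q} → 0ℚ ≤ q → 0ℚ ≤ counts x j q
    counts-nonNeg x j 0≤q = when-nonNeg (asg j Finₚ.≟ x) (when-nonNeg (cls j ℤₚ.≤? k) 0≤q)

    counts-mono : ∀ x j {q r} → q ≤ r → counts x j q ≤ counts x j r
    counts-mono x j q≤r with asg j Finₚ.≟ x | cls j ℤₚ.≤? k
    ... | yes _ | yes _ = q≤r
    ... | yes _ | no _  = ≤-refl
    ... | no _  | _     = ≤-refl

    -- Strict arrival: a request arriving exactly at t cannot have been served by t.
    Uk< : Fin m → ℚ → ℚ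
    Uk< x t = sumFin (λ j → when (a j <? t) (counts x j (ℓ j)))

    Pk≤Uk< : ∀ x t → Pk x t ≤ Uk< x t
    Pk≤Uk< x t = subst (_≤ Uk< x t) (sym (Pk≡sum-of-done x t)) (sumFin-mono bound)
      where
      bound : ∀ j → counts x j (done j t) ≤ when (a j <? t) (counts x j (ℓ j))
      bound j with a j <? t
      ... | yes _   = counts-mono x j (done-≤-size j t)
      ... | no  a≮t =
        ≤-reflexive (trans (cong (counts x j) (done-before-arrival j (≮⇒≥ a≮t))) (counts-0 x j))

    NoneWaiting : Fin m → ℚ → Set
    NoneWaiting x u = ∀ i → asg i ≡ x → cls i ℤ.≤ k → ¬ Pending s a ℓ τ run i u

    Cleared : Fin m → ℚ → Set
    Cleared x t = Uk< x t ≤ Pk x t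

    Drained : Fin m → ℚ → Set
    Drained x t = ∀ j → asg j ≡ x → cls j ℤ.≤ k → a j < t → ∃[ u ] a j ≤ u × u ≤ t × NoneWaiting x u

    cleared-if-drained : ∀ x t → Drained x t → Cleared x t
    cleared-if-drained x t waited = subst (Uk< x t ≤_) (sym (Pk≡sum-of-done x t)) (sumFin-mono bound)
      where
      bound : ∀ j → when (a j <? t) (counts x j (ℓ j)) ≤ counts x j (done j t)
      bound j with a j <? t
      ... | no _ = counts-nonNeg x j (done-nonNeg j t)
      ... | yes a<t with asg j Finₚ.≟ x | cls j ℤₚ.≤? k
      ...   | no _          | _       = ≤-refl
      ...   | yes _         | no _    = ≤-refl
      ...   | yes assigned | yes low with waited j assigned low a<t
      ...     | u , a≤u , u≤t , none =
        ≤-trans (≮⇒≥ (λ done<ℓ → none j assigned low (a≤u , done<ℓ))) (done-mono j u≤t)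

    cleared-if-none-waiting : ∀ x t → NoneWaiting x t → Cleared x t
    cleared-if-none-waiting x t none = cleared-if-drained x t (λ j _ _ a<t → t , <⇒≤ a<t , ≤-refl , none)

    classRate : Maybe (Fin n) → ℚ
    classRate nothing  = 0ℚ
    classRate (just j) = when (cls j ℤₚ.≤? k) 1ℚ

    classRate-≤1 : ∀ o → classRate o ≤ 1ℚ
    classRate-≤1 nothing  = nonNegative⁻¹ 1ℚ
    classRate-≤1 (just j) = when-≤ (cls j ℤₚ.≤? k) (nonNegative⁻¹ 1ℚ)

    Busy : Maybe (Fin n) → Set
    Busy nothing  = ⊥
    Busy (just j) = cls j ℤ.≤ k

    busy? : ∀ o → Dec (Busy o)
    busy? nothing  = no (λ ())
    busy? (just j) = cls j ℤₚ.≤? k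

    classRate-busy : ∀ o → Busy o → classRate o ≡ 1ℚ
    classRate-busy (just j) low = when-yes (cls j ℤₚ.≤? k) low 1ℚ

    Pk≡integral : ∀ x t → Pk x t ≡ s * integral (λ r → classRate (run r x)) t
    Pk≡integral x t = cong (s *_) (sumFin-cong (λ r → runsLe≡classRate* (run r x) (lenBefore τ r t)))
      where
      runsLe≡classRate* : ∀ o q → runsLe cls k o q ≡ classRate o * q
      runsLe≡classRate* nothing  q = sym (*-zeroˡ q)
      runsLe≡classRate* (just j) q with cls j ℤₚ.≤? k
      ... | yes _ = sym (*-identityˡ q)
      ... | no _  = sym (*-zeroˡ q)

    Pk-affine : ∀ x r {u t} → lo τ r ≤ u → u ≤ t → t ≤ hi τ r →
      Pk x t ≡ Pk x u + (s * classRate (run r x)) * (t - u)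
    Pk-affine x r {u} {t} lo≤u u≤t t≤hi =
      trans (Pk≡integral x t) (trans (*-integral-affine s (λ r → classRate (run r x)) r lo≤u u≤t t≤hi)
        (cong (_+ (s * classRate (run r x)) * (t - u)) (sym (Pk≡integral x u))))

    lag : Fin m → Fin m → ℚ → ℚ
    lag x y t = Pk y t - Pk x t

    lag-nonincreasing-while-busy : ∀ x y r {u t} → Busy (run r x) →
      lo τ r ≤ u → u ≤ t → t ≤ hi τ r → lag x y t ≤ lag x y u
    lag-nonincreasing-while-busy x y r {u} {t} busy lo≤u u≤t t≤hi = begin
      Pk y t - Pk x t
        ≡⟨ cong₂ _-_ (Pk-affine y r lo≤u u≤t t≤hi)
             (trans (Pk-affine x r lo≤u u≤t t≤hi)
                    (cong (λ c → Pk x u + (s * c) * (t - u)) (classRate-busy (run r x) busy))) ⟩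
      (Pk y u + (s * c) * (t - u)) - (Pk x u + (s * 1ℚ) * (t - u))
        ≡⟨ solve 5 (λ py px s c e → (py :+ (s :* c) :* e) :- (px :+ (s :* con 1ℚ) :* e)
                                    := (py :- px) :+ (s :* e) :* (c :- con 1ℚ)) refl (Pk y u) (Pk x u) s c (t - u) ⟩
      lag x y u + (s * (t - u)) * (c - 1ℚ)
        ≤⟨ +-monoʳ-≤ (lag x y u)
             (*-monoˡ-≤-0≤ (0≤p*q 0≤s (p≤q⇒0≤q-p u≤t))
                           (p≤q⇒p-q≤0 (classRate-≤1 (run r y)))) ⟩
      lag x y u + (s * (t - u)) * 0ℚ
        ≡⟨ trans (cong (_+_ (lag x y u)) (*-zeroʳ (s * (t - u)))) (+-identityʳ (lag x y u)) ⟩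
      lag x y u ∎
      where
      open ≤-Reasoning
      c : ℚ
      c = classRate (run r y)

    module Clearing (inClass : ∀ i → InClass (cls i) (slack a d i)) (x y : Fin m) where

      none-waiting-if-idle : ∀ {u} → Idle τ run x u → NoneWaiting x u
      none-waiting-if-idle idle i assigned _ = proj₂ (proj₂ ssf) x _ idle i assigned

      none-waiting-before-τ₀ : ∀ {u} → u < τ zero → NoneWaiting x u
      none-waiting-before-τ₀ u<τ₀ = none-waiting-if-idle (λ r lo≤u _ →
        ⊥-elim (<-irrefl refl (<-≤-trans u<τ₀ (≤-trans (τ₀≤lo r) lo≤u))))

      none-waiting-after-τN : ∀ {u} → τ (fromℕ N) ≤ u → NoneWaiting x u
      none-waiting-after-τN τN≤u = none-waiting-if-idle (λ r _ u<hi →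
        ⊥-elim (<-irrefl refl (<-≤-trans u<hi (≤-trans (hi≤τN r) τN≤u))))

      none-waiting-in-lazy-slot : ∀ r {u} → lo τ r ≤ u → u < hi τ r → ¬ Busy (run r x) → NoneWaiting x u
      none-waiting-in-lazy-slot r {u} lo≤u u<hi lazy with run r x in runs
      ... | nothing = none-waiting-if-idle (λ r′ lo′≤u u<hi′ →
        trans (cong (λ z → run z x) (interval-unique lo≤u u<hi lo′≤u u<hi′)) runs)
      ... | just j = λ i assigned low pending → <-irrefl refl (slack-i<slack-i i assigned low pending)
        where
        slack-i<slack-i : ∀ i → asg i ≡ x → cls i ℤ.≤ k → Pending s a ℓ τ run i u →
          slack a d i < slack a d i
        slack-i<slack-i i assigned low pending = begin-strict
          slack a d i            <⟨ proj₂ (inClass i) ⟩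
          pow2 (cls i ℤ.+ + 1)   ≤⟨ pow2-mono (ℤₚ.+-monoˡ-≤ (+ 1) low) ⟩
          pow2 (k ℤ.+ + 1)       ≤⟨ pow2-mono (i<j⇒i+1≤j (ℤₚ.≰⇒> lazy)) ⟩
          pow2 (cls j)           ≤⟨ proj₁ (inClass j) ⟩
          slack a d j            ≤⟨ shortest-slack i assigned pending ⟩
          slack a d i            ∎
          where
          open ≤-Reasoning
          shortest-slack : ∀ i → asg i ≡ x → Pending s a ℓ τ run i u → slack a d j ≤ slack a d i
          shortest-slack = proj₂ (proj₂ (proj₁ (proj₂ ssf) x u j (r , lo≤u , u<hi , runs)))

      ClearedSince : ℚ → Set
      ClearedSince t = ∃[ t₀ ] Cleared x t₀ × lag x y t ≤ lag x y t₀

      clearedSince-τ₀ : ClearedSince (τ zero)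
      clearedSince-τ₀ = τ zero , cleared-if-drained x (τ zero) drained , ≤-refl
        where
        drained : Drained x (τ zero)
        drained j _ _ a<τ₀ = a j , ≤-refl , <⇒≤ a<τ₀ , none-waiting-before-τ₀ a<τ₀

      clearedSince-hi : ∀ r → ClearedSince (lo τ r) → ClearedSince (hi τ r)
      clearedSince-hi r (t₀ , cleared , lag≤) with busy? (run r x)
      ... | yes busy =
        t₀ , cleared , ≤-trans (lag-nonincreasing-while-busy x y r busy ≤-refl (<⇒≤ (proj₁ ssf r)) ≤-refl) lag≤
      ... | no  lazy = hi τ r , cleared-if-drained x (hi τ r) drained , ≤-refl
        where
        drained : Drained x (hi τ r)
        drained j _ _ a<hi = a j ⊔ lo τ r , p≤p⊔q (a j) (lo τ r) , <⇒≤ a⊔lo<hi ,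
          none-waiting-in-lazy-slot r (p≤q⊔p (a j) (lo τ r)) a⊔lo<hi lazy
          where
          a⊔lo<hi : a j ⊔ lo τ r < hi τ r
          a⊔lo<hi with ⊔-sel (a j) (lo τ r)
          ... | inj₁ ≡a  = subst (_< hi τ r) (sym ≡a) a<hi
          ... | inj₂ ≡lo = subst (_< hi τ r) (sym ≡lo) (proj₁ ssf r)

      clearedSince : ∀ t → ClearedSince t
      clearedSince t with locate τ t
      ... | before t<τ₀ = t , cleared-if-none-waiting x t (none-waiting-before-τ₀ t<τ₀) , ≤-refl
      ... | after τN≤t  = t , cleared-if-none-waiting x t (none-waiting-after-τN τN≤t) , ≤-refl
      ... | inside r lo≤t t<hi with busy? (run r x)
      ...   | no  lazy = t , cleared-if-none-waiting x t (none-waiting-in-lazy-slot r lo≤t t<hi lazy) , ≤-refl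
      ...   | yes busy with <-weakInduction (ClearedSince ∘ τ) clearedSince-τ₀ clearedSince-hi (inject₁ r)
      ...     | t₀ , cleared , lag≤ =
        t₀ , cleared , ≤-trans (lag-nonincreasing-while-busy x y r busy ≤-refl lo≤t (<⇒≤ t<hi)) lag≤

      lag-≤-arrivals : ∀ t → ∃[ t₀ ] lag x y t ≤ Uk< y t₀ - Uk< x t₀
      lag-≤-arrivals t with clearedSince t
      ... | t₀ , cleared , lag≤ = t₀ , ≤-trans lag≤ (-‿mono-≤ (Pk≤Uk< y t₀) cleared)

R≤-difference-≤ : ∀ {m n N} s → 0ℚ ≤ s →
  (a d ℓ : Fin n → ℚ) (cls : Fin n → ℤ) → ValidInstance a d ℓ cls →
  (asg : Fin n → Fin m) → SSF-I-Assignment ℓ cls asg →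
  (τ : Fin (suc N) → ℚ) (run : Fin N → Fin m → Maybe (Fin n)) → IsSSFSchedule s a d ℓ asg τ run →
  ∀ x y k t → R≤ s a ℓ cls asg τ run x k t - R≤ s a ℓ cls asg τ run y k t ≤ pow2 (k ℤ.+ + 3)
R≤-difference-≤ s 0≤s a d ℓ cls (0≤ℓ , ℓ≤slack , inClass , ordered) asg ssf-i τ run ssf x y k t = begin
  (U≤ a ℓ cls asg x k t - Pk x t) - (U≤ a ℓ cls asg y k t - Pk y t)
    ≡⟨ solve 4 (λ ux px uy py → (ux :- px) :- (uy :- py) := (ux :- uy) :+ (py :- px))
               refl (U≤ a ℓ cls asg x k t) (Pk x t) (U≤ a ℓ cls asg y k t) (Pk y t) ⟩
  (U≤ a ℓ cls asg x k t - U≤ a ℓ cls asg y k t) + lag x y t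
    ≤⟨ +-mono-≤ (Arrived.load≤-balanced k x y) lag-bound ⟩
  pow2 (k ℤ.+ + 2) + pow2 (k ℤ.+ + 2)
    ≡⟨ trans (sym (pow2-+1 (k ℤ.+ + 2))) (cong pow2 (ℤₚ.+-assoc k (+ 2) (+ 1))) ⟩
  pow2 (k ℤ.+ + 3) ∎
  where
  open ≤-Reasoning
  open Schedule.UpToClass s 0≤s a d ℓ 0≤ℓ asg τ run ssf cls k
  ℓ≤2^[cls+1] : ∀ j → ℓ j ≤ pow2 (cls j ℤ.+ + 1)
  ℓ≤2^[cls+1] j = <⇒≤ (≤-<-trans (ℓ≤slack j) (proj₂ (inClass j)))
  module Arrived = Loads ℓ cls asg 0≤ℓ ℓ≤2^[cls+1] ssf-i (λ j → a j ≤? t)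
    (λ i j i<j a≤t → ≤-trans (ordered i j i<j) a≤t)
  module ArrivedBefore (t₀ : ℚ) = Loads ℓ cls asg 0≤ℓ ℓ≤2^[cls+1] ssf-i (λ j → a j <? t₀)
    (λ i j i<j a<t₀ → ≤-<-trans (ordered i j i<j) a<t₀)
  lag-bound : lag x y t ≤ pow2 (k ℤ.+ + 2)
  lag-bound with Clearing.lag-≤-arrivals inClass x y t
  ... | t₀ , lag≤ = ≤-trans lag≤ (ArrivedBefore.load≤-balanced t₀ k y x)

lemma2p8 : (m n : ℕ) (s : ℚ) → 0ℚ < s →
  (a d ℓ : Fin n → ℚ) (cls : Fin n → ℤ) → ValidInstance a d ℓ cls →
  (asg : Fin n → Fin m) → SSF-I-Assignment ℓ cls asg →
  (N : ℕ) (τ : Fin (suc N) → ℚ) (run : Fin N → Fin m → Maybe (Fin n)) →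
  IsSSFSchedule s a d ℓ asg τ run →
  (x y : Fin m) (k : ℤ) (t : ℚ) →
  ∣ R≤ s a ℓ cls asg τ run x k t - R≤ s a ℓ cls asg τ run y k t ∣ ≤ pow2 (k ℤ.+ + 3)
lemma2p8 m n s 0<s a d ℓ cls valid asg ssf-i N τ run ssf x y k t =
  p≤r⇒-p≤r⇒∣p∣≤r (difference-≤ x y)
    (subst (_≤ pow2 (k ℤ.+ + 3)) (solve 2 (λ p q → q :- p := :- (p :- q)) refl (R x) (R y)) (difference-≤ y x))
  where
  R : Fin m → ℚ
  R z = R≤ s a ℓ cls asg τ run z k t
  difference-≤ : ∀ u v → R u - R v ≤ pow2 (k ℤ.+ + 3)
  difference-≤ u v = R≤-difference-≤ s (<⇒≤ 0<s) a d ℓ cls valid asg ssf-i τ run ssf u v k t
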